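{- Let $X$ be a super $X$-set parameter and let $\Phi$ be an $X$-compliant closure family. Then $\mathcal{B}_X^{\min}\subseteq \mathcal{B}_{X,\Phi}$ (i.e., $B_X^{\min}(G)\subseteq B_{X,\Phi}(G)$ for every graph $G$), and hence $\mathcal{B}_{X,\Phi}$ is an $X$-irredundant blocking family.
   Context: Graphs are finite, simple, with nonempty vertex set. A super $X$-set parameter $X$ is specified by an isomorphism-invariant property of vertex subsets (the $X$-sets) such that every graph has an $X$-set and supersets of $X$-sets are $X$-sets. $R\subseteq V(G)$ is an $X$-blocking set if $V(G)\setminus R$ is not an $X$-set; it is a minimal $X$-blocking set if no proper subset is an $X$-blocking set; $B_X^{\min}(G)$ is the set of minimal $X$-blocking sets. An $X$-blocking family assigns to each graph $G$ a set $B_X(G)$ of $X$-blocking sets, compatibly with isomorphism; it is $X$-irredundant if for every graph $G$ and $S\subseteq V(G)$: $S$ is an $X$-set iff $S\cap R\ne\emptyset$ for all $R\in B_X(G)$. A closure operator on $V$ is a map $\varphi:\mathcal{P}(V)\to\mathcal{P}(V)$ with $A\subseteq\varphi(A)$, $A_1\subseteq A_2\Rightarrow \varphi(A_1)\subseteq\varphi(A_2)$, and $\varphi\circ\varphi=\varphi$. A closure family $\Phi=\{\varphi_G\}$ assigns a closure operator $\varphi_G$ on $V(G)$ to each graph $G$ such that for every isomorphism $\psi:V(G)\to V(H)$ and $A\subseteq V(G)$, $\psi(\varphi_G(A))=\varphi_H(\psi(A))$. $\Phi$ is $X$-compliant if for every graph $G$, $S$ is an $X$-set iff $\varphi_G(S)=V(G)$.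 Then $B_{X,\Phi}(G)=\{V(G)\setminus\varphi_G(A): A\subseteq V(G)\text{ is not an }X\text{ -set}\}$ and $\mathcal{B}_{X,\Phi}$ is the resulting family. -}

module Defs where

open import Data.Nat using (ℕ; _≤_)
open import Data.Bool using (Bool; false)
open import Data.Fin using (Fin)
open import Data.Fin.Subset using (Subset; _⊆_; _⊂_; ∁; _∩_; ⊤; Nonempty)
open import Data.Vec using (tabulate; lookup)
open import Data.Product using (Σ; ∃; _×_)
open import Function.Bundles using (_↔_; Inverse; _⇔_)
open import Relation.Nullary using (¬_)
open import Relation.Binary.PropositionalEquality using (_≡_)

record Graph : Set where
  field
    n        : ℕ
    nonempty : 1 ≤ n
    adj      : Fin n → Fin n → Bool
    adj-sym  : ∀ i j → adj i j ≡ adj j i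
    irrefl   : ∀ i → adj i i ≡ false
open Graph public

V : Graph → Set
V G = Fin (n G)

VSet : Graph → Set
VSet G = Subset (n G)

record Iso (G H : Graph) : Set where
  field
    bij  : V G ↔ V H
    pres : ∀ i j → adj H (Inverse.to bij i) (Inverse.to bij j) ≡ adj G i j
open Iso public

img : {G H : Graph} → Iso G H → VSet G → VSet H
img ψ A = tabulate (λ j → lookup A (Inverse.from (bij ψ) j))

record SuperXSetParameter : Set₁ where
  field
    IsX       : (G : Graph) → VSet G → Set
    iso-inv   : ∀ (G H : Graph) (ψ : Iso G H) (S : VSet G) → IsX G S ⇔ IsX H (img ψ S)
    has-X-set : ∀ (G : Graph) → ∃ λ (S : VSet G) → IsX G S
    superset  : ∀ (G : Graph) (S T : VSet G) → S ⊆ T → IsX G S → IsX G T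
open SuperXSetParameter public

record ClosureFamily : Set where
  field
    φ         : (G : Graph) → VSet G → VSet G
    extensive : ∀ (G : Graph) (A : VSet G) → A ⊆ φ G A
    monotone  : ∀ (G : Graph) (A₁ A₂ : VSet G) → A₁ ⊆ A₂ → φ G A₁ ⊆ φ G A₂
    idem      : ∀ (G : Graph) (A : VSet G) → φ G (φ G A) ≡ φ G A
    iso-compat : ∀ (G H : Graph) (ψ : Iso G H) (A : VSet G) → img ψ (φ G A) ≡ φ H (img ψ A)
open ClosureFamily public

module _ (X : SuperXSetParameter) where

  Compliant : ClosureFamily → Set
  Compliant Φ = ∀ (G : Graph) (S : VSet G) → IsX X G S ⇔ (φ Φ G S ≡ ⊤)

  IsBlocking : (G : Graph) → VSet G → Set
  IsBlocking G R = ¬ IsX X G (∁ R)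

  IsMinBlocking : (G : Graph) → VSet G → Set
  IsMinBlocking G R = IsBlocking G R × (∀ (R' : VSet G) → R' ⊂ R → ¬ IsBlocking G R')

  Family : Set₁
  Family = (G : Graph) → VSet G → Set

  IsBlockingFamily : Family → Set
  IsBlockingFamily B =
    (∀ (G : Graph) (R : VSet G) → B G R → IsBlocking G R) ×
    (∀ (G H : Graph) (ψ : Iso G H) (R : VSet G) → B G R ⇔ B H (img ψ R))

  IsIrredundant : Family → Set
  IsIrredundant B = ∀ (G : Graph) (S : VSet G) →
    IsX X G S ⇔ (∀ (R : VSet G) → B G R → Nonempty (S ∩ R))

  BXΦ : ClosureFamily → Family
  BXΦ Φ G R = Σ (VSet G) λ A → ¬ IsX X G A × (R ≡ ∁ (φ Φ G A))

-- A minimal X-blocking set R is the complement of the closure of the non-X-set V ∖ R: that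
-- complement lies inside R and is still blocking, so minimality forces equality.
-- Irredundance: an X-set S cannot lie inside the closure of a non-X-set A (the closure, and
-- hence A, would be an X-set), while a non-X-set S misses the member V ∖ φ(S).
module Submission where

open import Defs
open import Data.Product using (_×_; _,_)
open import Data.Bool using (_≟_)
open import Data.Empty using (⊥-elim)
open import Data.Fin.Subset using (Subset; _⊆_; ∁; _∩_; ⊤; Empty; Nonempty)
open import Data.Fin.Subset.Properties
  using (⊆-antisym; nonempty?; _∈?_; x∈p∩q⁺; x∈p∩q⁻; x∈∁p⇒x∉p; x∉p⇒x∈∁p; p⊆q⇒∁p⊇∁q; ∪-∩-booleanAlgebra)
open import Algebra.Lattice.Properties.BooleanAlgebra using (¬-involutive)
open import Data.Vec using (lookup)
open import Data.Vec.Properties using (lookup∘tabulate; tabulate∘lookup; tabulate-cong; tabulate-∘; lookup-map; ≡-dec)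
open import Function.Bundles using (Inverse; _⇔_; mk⇔; Equivalence)
open import Function.Properties.Inverse using (↔-sym)
open import Relation.Nullary using (¬_; yes; no)
open import Relation.Nullary.Decidable using (decidable-stable)
open import Relation.Binary.PropositionalEquality using (_≡_; refl; sym; trans; cong; cong₂; subst)

∁-involutive : ∀ {m} (p : Subset m) → ∁ (∁ p) ≡ p
∁-involutive {m} = ¬-involutive (∪-∩-booleanAlgebra m)

Empty-∩∁⇒⊆ : ∀ {m} {p q : Subset m} → Empty (p ∩ ∁ q) → p ⊆ q
Empty-∩∁⇒⊆ {q = q} empty {x} x∈p with x ∈? q
... | yes x∈q = x∈q
... | no x∉q = ⊥-elim (empty (x , x∈p∩q⁺ (x∈p , x∉p⇒x∈∁p x∉q)))

⊆⇒Empty-∩∁ : ∀ {m} {p q : Subset m} → p ⊆ q → Empty (p ∩ ∁ q)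
⊆⇒Empty-∩∁ {p = p} p⊆q (x , x∈p∩∁q) with x∈p∩q⁻ p _ x∈p∩∁q
... | x∈p , x∈∁q = x∈∁p⇒x∉p x∈∁q (p⊆q x∈p)

Iso-sym : {G H : Graph} → Iso G H → Iso H G
Iso-sym {G} {H} ψ = record
  { bij  = ↔-sym (bij ψ)
  ; pres = λ i j → trans (sym (pres ψ (from i) (from j)))
                         (cong₂ (adj H) (Inverse.strictlyInverseˡ (bij ψ) i)
                                        (Inverse.strictlyInverseˡ (bij ψ) j))
  }
  where from = Inverse.from (bij ψ)

img-∁ : {G H : Graph} (ψ : Iso G H) (A : VSet G) → img ψ (∁ A) ≡ ∁ (img ψ A)
img-∁ ψ A = trans (tabulate-cong (λ j → lookup-map (Inverse.from (bij ψ) j) _ A))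
                  (tabulate-∘ _ _)

img-sym-img : {G H : Graph} (ψ : Iso G H) (A : VSet G) → img (Iso-sym ψ) (img ψ A) ≡ A
img-sym-img ψ A =
  trans (tabulate-cong λ i → trans (lookup∘tabulate _ (Inverse.to (bij ψ) i))
                                   (cong (lookup A) (Inverse.strictlyInverseʳ (bij ψ) i)))
        (tabulate∘lookup A)

module _ (X : SuperXSetParameter) where

  ⊆-blocking⇒⊇-minimal : ∀ G {R R'} → IsMinBlocking X G R → R' ⊆ R → IsBlocking X G R' → R ⊆ R'
  ⊆-blocking⇒⊇-minimal G {R} {R'} (_ , minimal) R'⊆R R'-blocking {x} x∈R with x ∈? R'
  ... | yes x∈R' = x∈R'
  ... | no x∉R' = ⊥-elim (minimal R' (R'⊆R , x , x∈R , x∉R') R'-blocking)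

  module _ (Φ : ClosureFamily) (compliant : Compliant X Φ) where

    IsX-φ⇒IsX : ∀ G A → IsX X G (φ Φ G A) → IsX X G A
    IsX-φ⇒IsX G A φA-X = Equivalence.from (compliant G A)
      (trans (sym (idem Φ G A)) (Equivalence.to (compliant G (φ Φ G A)) φA-X))

    ∁φ-blocking : ∀ G A → ¬ IsX X G A → IsBlocking X G (∁ (φ Φ G A))
    ∁φ-blocking G A A-notX ∁∁φA-X =
      A-notX (IsX-φ⇒IsX G A (subst (IsX X G) (∁-involutive _) ∁∁φA-X))

    minBlocking⇒BXΦ : ∀ G R → IsMinBlocking X G R → BXΦ X Φ G R
    minBlocking⇒BXΦ G R R-min@(R-blocking , _) = ∁ R , R-blocking , R≡∁φ∁R
      where
        ∁φ∁R⊆R : ∁ (φ Φ G (∁ R)) ⊆ R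
        ∁φ∁R⊆R = subst (∁ (φ Φ G (∁ R)) ⊆_) (∁-involutive R)
                       (p⊆q⇒∁p⊇∁q (extensive Φ G (∁ R)))
        R≡∁φ∁R : R ≡ ∁ (φ Φ G (∁ R))
        R≡∁φ∁R = ⊆-antisym
          (⊆-blocking⇒⊇-minimal G R-min ∁φ∁R⊆R (∁φ-blocking G (∁ R) R-blocking))
          ∁φ∁R⊆R

    BXΦ-blocking : ∀ G R → BXΦ X Φ G R → IsBlocking X G R
    BXΦ-blocking G _ (A , A-notX , refl) = ∁φ-blocking G A A-notX

    BXΦ-img : ∀ G H (ψ : Iso G H) R → BXΦ X Φ G R → BXΦ X Φ H (img ψ R)
    BXΦ-img G H ψ _ (A , A-notX , refl) =
      img ψ A , (λ ψA-X → A-notX (Equivalence.from (iso-inv X G H ψ A) ψA-X)) ,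
      trans (img-∁ ψ (φ Φ G A)) (cong ∁ (iso-compat Φ G H ψ A))

    BXΦ-iso : ∀ G H (ψ : Iso G H) R → BXΦ X Φ G R ⇔ BXΦ X Φ H (img ψ R)
    BXΦ-iso G H ψ R = mk⇔ (BXΦ-img G H ψ R) λ ψR∈B →
      subst (BXΦ X Φ G) (img-sym-img ψ R) (BXΦ-img H G (Iso-sym ψ) (img ψ R) ψR∈B)

    BXΦ-irredundant : IsIrredundant X (BXΦ X Φ)
    BXΦ-irredundant G S = mk⇔ meets-all meets-all⇒X
      where
        meets-all : IsX X G S → ∀ R → BXΦ X Φ G R → Nonempty (S ∩ R)
        meets-all S-X _ (A , A-notX , refl) = decidable-stable (nonempty? _) λ S∩∁φA-empty →
          A-notX (IsX-φ⇒IsX G A (superset X G S _ (Empty-∩∁⇒⊆ S∩∁φA-empty) S-X))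
        meets-all⇒X : (∀ R → BXΦ X Φ G R → Nonempty (S ∩ R)) → IsX X G S
        meets-all⇒X meets = Equivalence.from (compliant G S)
          (decidable-stable (≡-dec _≟_ (φ Φ G S) ⊤) λ φS≢⊤ →
            ⊆⇒Empty-∩∁ (extensive Φ G S)
              (meets _ (S , (λ S-X → φS≢⊤ (Equivalence.to (compliant G S) S-X)) , refl)))

proposition4p8 : (X : SuperXSetParameter) (Φ : ClosureFamily) → Compliant X Φ →
    (∀ (G : Graph) (R : VSet G) → IsMinBlocking X G R → BXΦ X Φ G R) ×
    (IsBlockingFamily X (BXΦ X Φ) × IsIrredundant X (BXΦ X Φ))
proposition4p8 X Φ compliant =
  minBlocking⇒BXΦ X Φ compliant ,
  (BXΦ-blocking X Φ compliant , BXΦ-iso X Φ compliant) ,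
  BXΦ-irredundant X Φ compliant
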